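{- If $m,n\equiv 0\pmod 4$ and $m,n>4$, then the direct product $C_m\times C_n$ is a distance magic graph but not a balanced distance magic graph.
   Context: $C_n$ denotes the cycle on $n$ vertices. The direct product $G\times H$ has vertex set $V(G)\times V(H)$, with $(g,h)$ adjacent to $(g',h')$ iff $gg'\in E(G)$ and $hh'\in E(H)$. $N(x)$ is the open neighborhood of $x$. A graph $X$ of order $N$ is distance magic if there is a bijection $\ell\colon V(X)\to\{1,\ldots,N\}$ and a positive integer $k$ such that $\sum_{y\in N(x)}\ell(y)=k$ for every vertex $x$. A distance magic graph $X$ with an even number of vertices is balanced distance magic if there exists a bijection $\ell\colon V(X)\to\{1,\ldots,|V(X)|\}$ such that for every $w\in V(X)$: whenever $u\in N(w)$ has $\ell(u)=i$, there exists $v\in N(w)$ with $\ell(v)=|V(X)|+1-i$. -}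

module Defs where

open import Data.Nat using (ℕ; zero; suc; _+_; _*_; _∸_; _%_; _>_; NonZero)
open import Data.Nat.Divisibility using (_∣_)
open import Data.Fin using (Fin; toℕ; remQuot)
open import Data.Fin.Properties using (_≟_)
open import Data.Bool using (Bool; true; false; _∧_; _∨_; if_then_else_)
open import Data.List using (List; map)
open import Data.Nat.ListAction using (sum)
open import Data.List using (allFin)
open import Data.Product using (Σ; ∃; _×_; _,_; proj₁; proj₂)
open import Relation.Binary.PropositionalEquality using (_≡_)
open import Relation.Nullary.Decidable using (⌊_⌋)
open import Function.Bundles using (_⤖_; Bijection)

record Graph : Set where
  field
    order : ℕ
    adj   : Fin order → Fin order → Bool
open Graph public

cycleAdj : (n : ℕ) → Fin n → Fin n → Bool
cycleAdj zero    () _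
cycleAdj (suc k) i j =
  ⌊ Data.Nat._≟_ (toℕ j) ((suc (toℕ i)) % suc k) ⌋
  ∨ ⌊ Data.Nat._≟_ (toℕ i) ((suc (toℕ j)) % suc k) ⌋

C : ℕ → Graph
C n = record { order = n ; adj = cycleAdj n }

-- Direct (tensor/categorical) product; vertex set Fin (|G| * |H|) ≅ Fin |G| × Fin |H|
-- via remQuot.
_×ᵍ_ : Graph → Graph → Graph
G ×ᵍ H = record
  { order = order G * order H
  ; adj = λ x y →
      let (g , h)   = remQuot (order H) x
          (g′ , h′) = remQuot (order H) y
      in adj G g g′ ∧ adj H h h′ }

-- A labelling of X: bijection from vertices to labels; vertex x gets label
-- toℕ (ℓ x) + 1 ∈ {1, …, |V(X)|}.
Labelling : Graph → Set
Labelling X = Fin (order X) ⤖ Fin (order X)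

label : (X : Graph) → Labelling X → Fin (order X) → ℕ
label X ℓ x = suc (toℕ (Bijection.to ℓ x))

neighSum : (X : Graph) → Labelling X → Fin (order X) → ℕ
neighSum X ℓ x =
  sum (map (λ y → if adj X x y then label X ℓ y else 0) (allFin (order X)))

IsDistanceMagic : Graph → Set
IsDistanceMagic X =
  Σ (Labelling X) λ ℓ → Σ ℕ λ k → (k > 0) × ((x : Fin (order X)) → neighSum X ℓ x ≡ k)

IsBalancedDistanceMagic : Graph → Set
IsBalancedDistanceMagic X =
  IsDistanceMagic X × (2 ∣ order X) ×
  Σ (Labelling X) λ ℓ →
    (w u : Fin (order X)) → adj X w u ≡ true →
      Σ (Fin (order X)) λ v →
        (adj X w v ≡ true) × (label X ℓ v ≡ suc (order X) ∸ label X ℓ u)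

-- Write a ↦ (phase a, rank a) for the bijection of ℕ with
-- Bool × ℕ given by a = 4r + 2t + e ↦ (t = 0, 2r + e), and, for H = m / 2,
-- fold H s x = H + x or H - 1 - x according to s; then s, x ↦ fold H s x is a
-- bijection of Bool × [0, H) onto [0, 2H) with fold H (not s) x + fold H s x
-- = 2H - 1.  The vertex (a, b) of C_m × C_n receives label
--   1 + n · fold (m/2) (phase b) (rank a) + fold (n/2) (phase a) (rank b).
-- The neighbours of (a, b) are (a ± 1, b ± 1); since a + 1 and a - 1 differ by
-- 2 modulo m ≡ 0 (mod 4) they have opposite phases, so the four neighbour
-- labels pair up and always add up to 4 + 2n(m - 1) + 2(n - 1).
--
-- Not balanced.  (0,0) and (2,2) have (1,1) as their only common neighbour
-- (this is where m, n ≠ 4 is used), and a graph of even order in which two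
-- vertices have a unique common neighbour cannot be balanced: the mate of
-- that neighbour with respect to both vertices would have to be the
-- neighbour itself, i.e. ℓ(u) = N + 1 - ℓ(u) with N even.
module Submission where

open import Defs
open import Data.Nat using (ℕ; zero; suc; _+_; _*_; _∸_; _%_; _<_; _≤_; _>_; pred; z≤n; s≤s)
open import Data.Nat.Properties
  using (<-irrefl; ≤-trans; ≤-reflexive; <-≤-trans; ≤-<-trans; m≤m+n; n≤1+n; m∸n≤m; m∸n+n≡m;
         +-monoʳ-<; +-identityʳ; +-cancelˡ-≡; +-comm; suc-injective; m≤n⇒m<n∨m≡n; ≤-pred; +-0-commutativeMonoid)
open import Data.Nat using () renaming (_≟_ to _ℕ-≟_)
open import Data.Nat.DivMod using (m%n<n; n%n≡0; m<n⇒m%n≡m)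
open import Data.Nat.Divisibility using (_∣_; divides; ∣m+n∣m⇒∣n; ∣1⇒≡1)
open import Data.Nat.Tactic.RingSolver using (solve-∀)
open import Data.Fin using (Fin; zero; suc; toℕ; fromℕ; fromℕ<; inject₁; combine; remQuot)
open import Data.Fin.Properties
  using (_≟_; any?; punchOut-injective; injective⇒≤; toℕ-injective; toℕ-fromℕ<; toℕ-fromℕ;
         toℕ-inject₁; toℕ<n; combine-injective; remQuot-combine; combine-remQuot; toℕ-combine)
open import Data.Fin.Base using (punchOut)
open import Data.Fin.Patterns using (0F; 1F; 2F)
open import Data.Bool using (Bool; true; false; _∧_; _∨_; if_then_else_; not)
open import Data.List using (map; allFin; tabulate)
open import Data.List.Properties using (map-tabulate)
open import Data.Nat.ListAction using (sum)
open import Data.Product using (_×_; _,_; proj₁; proj₂; uncurry)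
open import Data.Sum using (_⊎_; inj₁; inj₂)
open import Data.Empty using (⊥-elim)
open import Function.Base using (case_of_)
open import Relation.Nullary using (¬_; Dec; yes; no)
open import Relation.Nullary.Decidable using (does; isYes≗does; dec-true; dec-false)
open import Relation.Binary.PropositionalEquality
open import Function.Definitions using (Injective; Surjective)
open import Function.Bundles using (Bijection; mk⤖)
open import Algebra.Properties.CommutativeMonoid.Sum +-0-commutativeMonoid
  using (∑-distrib-+; sum-cong-≗) renaming (sum to ∑)

open ≡-Reasoning

injective⇒surjective : ∀ {N} (f : Fin N → Fin N) → Injective _≡_ _≡_ f → Surjective _≡_ _≡_ f
injective⇒surjective {zero}  f inj ()
injective⇒surjective {suc N} f inj y with any? (λ x → f x ≟ y)
... | yes (x , fx≡y) = x , λ { refl → fx≡y }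
... | no ∄x = ⊥-elim (<-irrefl refl (injective⇒≤ {f = g} g-injective))
  where
    -- f misses y, so f compressed to Fin N is still injective.
    y≢f : ∀ x → y ≢ f x
    y≢f x y≡fx = ∄x (x , sym y≡fx)
    g : Fin (suc N) → Fin N
    g x = punchOut (y≢f x)
    g-injective : Injective _≡_ _≡_ g
    g-injective {x} {x′} eq = inj (punchOut-injective (y≢f x) (y≢f x′) eq)

when : Bool → ℕ → ℕ
when b z = if b then z else 0

when-∧ : ∀ a b z → when (a ∧ b) z ≡ when a (when b z)
when-∧ true  b z = refl
when-∧ false b z = refl

when-+ : ∀ a x y → when a (x + y) ≡ when a x + when a y
when-+ true  x y = refl
when-+ false x y = refl

when-∨ : ∀ a b z → a ∧ b ≡ false → when (a ∨ b) z ≡ when a z + when b z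
when-∨ true  false z _ = sym (+-comm z 0)
when-∨ false b     z _ = refl

when-expand : ∀ a₁ a₂ b₁ b₂ z → a₁ ∧ a₂ ≡ false → b₁ ∧ b₂ ≡ false →
  when ((a₁ ∨ a₂) ∧ (b₁ ∨ b₂)) z
    ≡ (when (a₁ ∧ b₁) z + when (a₁ ∧ b₂) z) + (when (a₂ ∧ b₁) z + when (a₂ ∧ b₂) z)
when-expand a₁ a₂ b₁ b₂ z ea eb = begin
  when ((a₁ ∨ a₂) ∧ (b₁ ∨ b₂)) z
    ≡⟨ when-∧ (a₁ ∨ a₂) (b₁ ∨ b₂) z ⟩
  when (a₁ ∨ a₂) (when (b₁ ∨ b₂) z)
    ≡⟨ when-∨ a₁ a₂ _ ea ⟩
  when a₁ (when (b₁ ∨ b₂) z) + when a₂ (when (b₁ ∨ b₂) z)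
    ≡⟨ cong₂ (λ u v → when a₁ u + when a₂ v) (when-∨ b₁ b₂ z eb) (when-∨ b₁ b₂ z eb) ⟩
  when a₁ (when b₁ z + when b₂ z) + when a₂ (when b₁ z + when b₂ z)
    ≡⟨ cong₂ _+_ (when-+ a₁ _ _) (when-+ a₂ _ _) ⟩
  (when a₁ (when b₁ z) + when a₁ (when b₂ z)) + (when a₂ (when b₁ z) + when a₂ (when b₂ z))
    ≡⟨ sym (cong₂ _+_ (cong₂ _+_ (when-∧ a₁ b₁ z) (when-∧ a₁ b₂ z))
                      (cong₂ _+_ (when-∧ a₂ b₁ z) (when-∧ a₂ b₂ z))) ⟩
  (when (a₁ ∧ b₁) z + when (a₁ ∧ b₂) z) + (when (a₂ ∧ b₁) z + when (a₂ ∧ b₂) z) ∎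

_≐_ : ∀ {N} → Fin N → Fin N → Bool
x ≐ y = does (x ≟ y)

-- Finite sums.  `neighSum` sums a list over `allFin N`; it agrees with the
-- library's sum ∑ over Fin N, for which distributivity is available.
sum-allFin : ∀ {N} (F : Fin N → ℕ) → sum (map F (allFin N)) ≡ ∑ F
sum-allFin {N} F = trans (cong sum (map-tabulate (λ y → y) F)) (sum-tabulate F)
  where
    sum-tabulate : ∀ {N} (F : Fin N → ℕ) → sum (tabulate F) ≡ ∑ F
    sum-tabulate {zero}  F = refl
    sum-tabulate {suc N} F = cong (F zero +_) (sum-tabulate (λ y → F (suc y)))

∑-point : ∀ {N} (g : Fin N → ℕ) (v : Fin N) → ∑ (λ y → when (y ≐ v) (g y)) ≡ g v
∑-point {suc N} g zero    = trans (cong (g zero +_) (∑-zero (λ y → g (suc y)))) (+-identityʳ (g zero))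
  where
    ∑-zero : ∀ {N} (h : Fin N → ℕ) → ∑ (λ y → when (suc y ≐ zero) (h y)) ≡ 0
    ∑-zero {zero}  h = refl
    ∑-zero {suc N} h = ∑-zero (λ y → h (suc y))
∑-point {suc N} g (suc v) = ∑-point (λ y → g (suc y)) v

does-iff : ∀ {a b} {P : Set a} {Q : Set b} (p : Dec P) (q : Dec Q) →
  (P → Q) → (Q → P) → does p ≡ does q
does-iff (yes p) q P→Q Q→P = sym (dec-true q (P→Q p))
does-iff (no ¬p) q P→Q Q→P = sym (dec-false q (λ q → ¬p (Q→P q)))

next : ∀ {k} → Fin (suc k) → Fin (suc k)
next {k} i = fromℕ< (m%n<n (suc (toℕ i)) (suc k))

prev : ∀ {k} → Fin (suc k) → Fin (suc k)
prev {k} zero = fromℕ k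
prev (suc i)  = inject₁ i

interior-or-last : ∀ {k} (i : Fin (suc k)) → (toℕ i < k) ⊎ (toℕ i ≡ k)
interior-or-last i = m≤n⇒m<n∨m≡n (≤-pred (toℕ<n i))

toℕ-next-interior : ∀ {k} (i : Fin (suc k)) → toℕ i < k → toℕ (next i) ≡ suc (toℕ i)
toℕ-next-interior {k} i i<k = trans (toℕ-fromℕ< _) (m<n⇒m%n≡m (s≤s i<k))

toℕ-next-last : ∀ {k} (i : Fin (suc k)) → toℕ i ≡ k → toℕ (next i) ≡ 0
toℕ-next-last {k} i i≡k = trans (toℕ-fromℕ< _) (trans (cong (λ t → suc t % suc k) i≡k) (n%n≡0 (suc k)))

toℕ-prev-zero : ∀ {k} → toℕ (prev {k} zero) ≡ k
toℕ-prev-zero {k} = toℕ-fromℕ k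

toℕ-prev-suc : ∀ {k} (i : Fin k) → toℕ (prev (suc i)) ≡ toℕ i
toℕ-prev-suc i = toℕ-inject₁ i

prev-next : ∀ {k} (i : Fin (suc k)) → prev (next i) ≡ i
prev-next {k} i with interior-or-last i | next i in eq
... | inj₁ i<k | suc j = toℕ-injective (trans (toℕ-prev-suc j)
                           (suc-injective (trans (cong toℕ (sym eq)) (toℕ-next-interior i i<k))))
... | inj₁ i<k | zero  = case (trans (cong toℕ (sym eq)) (toℕ-next-interior i i<k)) of λ ()
... | inj₂ i≡k | zero  = toℕ-injective (trans toℕ-prev-zero (sym i≡k))
... | inj₂ i≡k | suc j = case (trans (cong toℕ (sym eq)) (toℕ-next-last i i≡k)) of λ ()

next-prev : ∀ {k} (i : Fin (suc k)) → next (prev i) ≡ i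
next-prev {k} zero    = toℕ-injective (toℕ-next-last (prev {k} zero) toℕ-prev-zero)
next-prev {k} (suc i) = toℕ-injective (trans
  (toℕ-next-interior (prev (suc i)) (subst (_< k) (sym (toℕ-prev-suc i)) (toℕ<n i)))
  (cong suc (toℕ-prev-suc i)))

cycleAdj-next-prev : ∀ {k} (i j : Fin (suc k)) →
  cycleAdj (suc k) i j ≡ (j ≐ next i) ∨ (j ≐ prev i)
cycleAdj-next-prev {k} i j = cong₂ _∨_
  (trans (isYes≗does (toℕ j ℕ-≟ suc (toℕ i) % suc k))
         (does-iff (toℕ j ℕ-≟ suc (toℕ i) % suc k) (j ≟ next i) from-next to-next))
  (trans (isYes≗does (toℕ i ℕ-≟ suc (toℕ j) % suc k))
         (does-iff (toℕ i ℕ-≟ suc (toℕ j) % suc k) (j ≟ prev i) from-prev to-prev))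
  where
    toℕ-next : ∀ (i : Fin (suc k)) → toℕ (next i) ≡ suc (toℕ i) % suc k
    toℕ-next i = toℕ-fromℕ< (m%n<n (suc (toℕ i)) (suc k))
    from-next : toℕ j ≡ suc (toℕ i) % suc k → j ≡ next i
    from-next e = toℕ-injective (trans e (sym (toℕ-next i)))
    to-next : j ≡ next i → toℕ j ≡ suc (toℕ i) % suc k
    to-next e = trans (cong toℕ e) (toℕ-next i)
    -- i = j + 1 is j = i - 1, since next and prev are mutually inverse.
    from-prev : toℕ i ≡ suc (toℕ j) % suc k → j ≡ prev i
    from-prev e = trans (sym (prev-next j)) (cong prev (toℕ-injective (trans (toℕ-next j) (sym e))))
    to-prev : j ≡ prev i → toℕ i ≡ suc (toℕ j) % suc k
    to-prev refl = trans (cong toℕ (sym (next-prev i))) (toℕ-next (prev i))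

next-prev-gap : ∀ {k} (i : Fin (suc (suc k))) →
  (2 + toℕ (prev i) ≡ toℕ (next i)) ⊎ (2 + toℕ (prev i) ≡ toℕ (next i) + suc (suc k))
next-prev-gap {k} zero = inj₂ (begin
  2 + toℕ (prev {suc k} zero) ≡⟨ cong (2 +_) toℕ-prev-zero ⟩
  1 + suc (suc k)             ≡⟨ cong (_+ suc (suc k)) (sym (toℕ-next-interior {suc k} zero (s≤s z≤n))) ⟩
  toℕ (next {suc k} zero) + suc (suc k) ∎)
next-prev-gap {k} (suc j) with interior-or-last (suc j)
... | inj₁ i<k = inj₁ (trans (cong (2 +_) (toℕ-prev-suc j)) (sym (toℕ-next-interior (suc j) i<k)))
... | inj₂ i≡k = inj₂ (begin
  2 + toℕ (prev (suc j))       ≡⟨ cong (2 +_) (toℕ-prev-suc j) ⟩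
  suc (toℕ (suc j))            ≡⟨ cong suc i≡k ⟩
  0 + suc (suc k)              ≡⟨ cong (_+ suc (suc k)) (sym (toℕ-next-last (suc j) i≡k)) ⟩
  toℕ (next (suc j)) + suc (suc k) ∎)

next≢prev : ∀ {k} (i : Fin (3 + k)) → next i ≢ prev i
next≢prev {k} i next≡prev with next-prev-gap i
... | inj₁ gap = 2+n≢n (trans gap (cong toℕ next≡prev))
  where
    2+n≢n : ∀ {n} → 2 + n ≢ n
    2+n≢n {suc n} e = 2+n≢n (suc-injective e)
... | inj₂ gap = case +-cancelˡ-≡ (toℕ (prev i)) _ _ shifted of λ ()
  where
    shifted : toℕ (prev i) + 2 ≡ toℕ (prev i) + (3 + k)
    shifted = trans (+-comm _ 2) (trans gap (cong (λ t → toℕ t + (3 + k)) next≡prev))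

next-prev-exclusive : ∀ {k} (i j : Fin (3 + k)) → (j ≐ next i) ∧ (j ≐ prev i) ≡ false
next-prev-exclusive i j with j ≟ next i
... | no  _         = refl
... | yes j≡next = dec-false (j ≟ prev i) (λ j≡prev → next≢prev i (trans (sym j≡next) j≡prev))

next-adj : ∀ {k} (i : Fin (suc k)) → cycleAdj (suc k) i (next i) ≡ true
next-adj i = trans (cycleAdj-next-prev i (next i)) (cong (_∨ (next i ≐ prev i)) (dec-true (next i ≟ next i) refl))

prev-adj : ∀ {k} (i : Fin (suc k)) → cycleAdj (suc k) i (prev i) ≡ true
prev-adj i = trans (cycleAdj-next-prev i (prev i)) (∨-true (prev i ≐ next i) (dec-true (prev i ≟ prev i) refl))
  where
    ∨-true : ∀ a {b} → b ≡ true → a ∨ b ≡ true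
    ∨-true true  _    = refl
    ∨-true false refl = refl

adj⇒next-or-prev : ∀ {k} (i j : Fin (suc k)) → cycleAdj (suc k) i j ≡ true → (j ≡ next i) ⊎ (j ≡ prev i)
adj⇒next-or-prev i j i~j with j ≟ next i | j ≟ prev i | trans (sym (cycleAdj-next-prev i j)) i~j
... | yes j≡next | _          | _ = inj₁ j≡next
... | no _       | yes j≡prev | _ = inj₂ j≡prev
... | no _       | no _       | ()

-- In a cycle of length at least 5 the vertices 0 and 2 have 1 as their only
-- common neighbour (in C_4 the vertex 3 would be another one); 1 is adjacent
-- to both.
common-neighbour-0-2 : ∀ {k} (a : Fin (5 + k)) →
  cycleAdj (5 + k) 0F a ≡ true → cycleAdj (5 + k) 2F a ≡ true → a ≡ 1F
common-neighbour-0-2 {k} a 0~a 2~a with adj⇒next-or-prev 0F a 0~a | adj⇒next-or-prev 2F a 2~a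
... | inj₁ a≡next0 | _ = toℕ-injective (trans (cong toℕ a≡next0) (toℕ-next-interior {4 + k} 0F (s≤s z≤n)))
... | inj₂ _ | inj₂ a≡prev2 = a≡prev2
... | inj₂ a≡prev0 | inj₁ a≡next2 = case 4+k≡3 of λ ()
  where
    4+k≡3 : 4 + k ≡ 3
    4+k≡3 = begin
      4 + k                  ≡⟨ sym (toℕ-prev-zero {4 + k}) ⟩
      toℕ (prev {4 + k} 0F)  ≡⟨ cong toℕ (trans (sym a≡prev0) a≡next2) ⟩
      toℕ (next {4 + k} 2F)  ≡⟨ toℕ-next-interior {4 + k} 2F (s≤s (s≤s (s≤s z≤n))) ⟩
      3 ∎

adj-0-1 : ∀ {k} → cycleAdj (5 + k) 0F 1F ≡ true
adj-0-1 {k} = subst (λ t → cycleAdj (5 + k) 0F t ≡ true)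
                    (toℕ-injective (toℕ-next-interior {4 + k} 0F (s≤s z≤n))) (next-adj {4 + k} 0F)

adj-2-1 : ∀ {k} → cycleAdj (5 + k) 2F 1F ≡ true
adj-2-1 {k} = prev-adj {4 + k} 2F

module CycleProduct (m′ n′ : ℕ) where

  m n : ℕ
  m = 3 + m′
  n = 3 + n′

  X : Graph
  X = C m ×ᵍ C n

  row : Fin (m * n) → Fin m
  row x = proj₁ (remQuot {m} n x)

  col : Fin (m * n) → Fin n
  col x = proj₂ (remQuot {m} n x)

  ≐-combine : ∀ y a b → (y ≐ combine a b) ≡ (row y ≐ a) ∧ (col y ≐ b)
  ≐-combine y a b with row y ≟ a | col y ≟ b | remQuot-combine {m} {n} a b
  ... | yes refl | yes refl | _ = dec-true (y ≟ combine (row y) (col y)) (sym (combine-remQuot {m} n y))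
  ... | yes _ | no col≢b | rq = dec-false (y ≟ combine a b) (λ { refl → col≢b (cong proj₂ rq) })
  ... | no row≢a | _ | rq = dec-false (y ≟ combine a b) (λ { refl → row≢a (cong proj₁ rq) })

  adj-combine : ∀ a b y → adj X (combine a b) y ≡ cycleAdj m a (row y) ∧ cycleAdj n b (col y)
  adj-combine a b y =
    cong (λ r → cycleAdj m (proj₁ r) (row y) ∧ cycleAdj n (proj₂ r) (col y)) (remQuot-combine {m} {n} a b)

  neighSum-diagonal : (ℓ : Labelling X) (x : Fin (m * n)) →
    let L = label X ℓ ; g = row x ; h = col x in
    neighSum X ℓ x ≡ (L (combine (next g) (next h)) + L (combine (next g) (prev h)))
                   + (L (combine (prev g) (next h)) + L (combine (prev g) (prev h)))
  neighSum-diagonal ℓ x = begin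
    neighSum X ℓ x
      ≡⟨ sum-allFin (λ y → when (adj X x y) (L y)) ⟩
    ∑ (λ y → when (adj X x y) (L y))
      ≡⟨ sum-cong-≗ split ⟩
    ∑ (λ y → (δ v₁₁ y + δ v₁₂ y) + (δ v₂₁ y + δ v₂₂ y))
      ≡⟨ ∑-distrib-+ (λ y → δ v₁₁ y + δ v₁₂ y) (λ y → δ v₂₁ y + δ v₂₂ y) ⟩
    ∑ (λ y → δ v₁₁ y + δ v₁₂ y) + ∑ (λ y → δ v₂₁ y + δ v₂₂ y)
      ≡⟨ cong₂ _+_ (∑-distrib-+ (δ v₁₁) (δ v₁₂)) (∑-distrib-+ (δ v₂₁) (δ v₂₂)) ⟩
    (∑ (δ v₁₁) + ∑ (δ v₁₂)) + (∑ (δ v₂₁) + ∑ (δ v₂₂))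
      ≡⟨ cong₂ _+_ (cong₂ _+_ (∑-point L v₁₁) (∑-point L v₁₂))
                   (cong₂ _+_ (∑-point L v₂₁) (∑-point L v₂₂)) ⟩
    (L v₁₁ + L v₁₂) + (L v₂₁ + L v₂₂) ∎
    where
      L : Fin (m * n) → ℕ
      L = label X ℓ
      g : Fin m
      g = row x
      h : Fin n
      h = col x
      v₁₁ v₁₂ v₂₁ v₂₂ : Fin (m * n)
      v₁₁ = combine (next g) (next h)
      v₁₂ = combine (next g) (prev h)
      v₂₁ = combine (prev g) (next h)
      v₂₂ = combine (prev g) (prev h)
      δ : Fin (m * n) → Fin (m * n) → ℕ
      δ v y = when (y ≐ v) (L y)
      δ-combine : ∀ a b y → when ((row y ≐ a) ∧ (col y ≐ b)) (L y) ≡ δ (combine a b) y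
      δ-combine a b y = cong (λ t → when t (L y)) (sym (≐-combine y a b))
      split : ∀ y → when (adj X x y) (L y) ≡ (δ v₁₁ y + δ v₁₂ y) + (δ v₂₁ y + δ v₂₂ y)
      split y = begin
        when (cycleAdj m g (row y) ∧ cycleAdj n h (col y)) (L y)
          ≡⟨ cong (λ t → when t (L y)) (cong₂ _∧_ (cycleAdj-next-prev {2 + m′} g (row y))
                                                   (cycleAdj-next-prev {2 + n′} h (col y))) ⟩
        when (((row y ≐ next g) ∨ (row y ≐ prev g)) ∧ ((col y ≐ next h) ∨ (col y ≐ prev h))) (L y)
          ≡⟨ when-expand (row y ≐ next g) (row y ≐ prev g) (col y ≐ next h) (col y ≐ prev h) (L y)
                         (next-prev-exclusive g (row y)) (next-prev-exclusive h (col y)) ⟩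
        _ ≡⟨ cong₂ _+_ (cong₂ _+_ (δ-combine (next g) (next h) y) (δ-combine (next g) (prev h) y))
                       (cong₂ _+_ (δ-combine (prev g) (next h) y) (δ-combine (prev g) (prev h) y)) ⟩
        (δ v₁₁ y + δ v₁₂ y) + (δ v₂₁ y + δ v₂₂ y) ∎

-- Writing a = 4r + 2t + e with t, e ∈ {0,1},
-- `phase a` records whether t = 0 and `rank a` = 2r + e; the pair
-- (phase a, rank a) determines a, and adding 2 flips the phase.

phase : ℕ → Bool
phase 0 = true
phase 1 = true
phase 2 = false
phase 3 = false
phase (suc (suc (suc (suc a)))) = phase a

rank : ℕ → ℕ
rank 0 = 0
rank 1 = 1
rank 2 = 0
rank 3 = 1
rank (suc (suc (suc (suc a)))) = 2 + rank a

unrank : Bool → ℕ → ℕ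
unrank s zero          = if s then 0 else 2
unrank s (suc zero)    = if s then 1 else 3
unrank s (suc (suc r)) = 4 + unrank s r

unrank-phase-rank : ∀ a → unrank (phase a) (rank a) ≡ a
unrank-phase-rank 0 = refl
unrank-phase-rank 1 = refl
unrank-phase-rank 2 = refl
unrank-phase-rank 3 = refl
unrank-phase-rank (suc (suc (suc (suc a)))) = cong (4 +_) (unrank-phase-rank a)

phase-rank-injective : ∀ {a a′} → phase a ≡ phase a′ → rank a ≡ rank a′ → a ≡ a′
phase-rank-injective {a} {a′} ep er = begin
  a                        ≡⟨ sym (unrank-phase-rank a) ⟩
  unrank (phase a) (rank a) ≡⟨ cong₂ unrank ep er ⟩
  unrank (phase a′) (rank a′) ≡⟨ unrank-phase-rank a′ ⟩
  a′ ∎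

phase-+2 : ∀ a → phase (2 + a) ≡ not (phase a)
phase-+2 0 = refl
phase-+2 1 = refl
phase-+2 2 = refl
phase-+2 3 = refl
phase-+2 (suc (suc (suc (suc a)))) = phase-+2 a

phase-periodic : ∀ P a → phase (a + P * 4) ≡ phase a
phase-periodic P a = trans (cong phase (+-comm a (P * 4))) (shift P)
  where
    shift : ∀ P → phase (P * 4 + a) ≡ phase a
    shift zero    = refl
    shift (suc P) = shift P

rank-< : ∀ P a → a < P * 4 → rank a < P * 2
rank-< (suc P) 0 _ = s≤s z≤n
rank-< (suc P) 1 _ = s≤s (s≤s z≤n)
rank-< (suc P) 2 _ = s≤s z≤n
rank-< (suc P) 3 _ = s≤s (s≤s z≤n)
rank-< (suc P) (suc (suc (suc (suc a)))) (s≤s (s≤s (s≤s (s≤s a<)))) =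
  s≤s (s≤s (rank-< P a a<))

-- `fold H` places [0, H) twice into [0, 2H): to the right of the middle when
-- the flag is true, mirrored to the left when it is false.  It is a
-- bijection Bool × [0, H) → [0, 2H), and mirror images add up to 2H - 1.

fold : ℕ → Bool → ℕ → ℕ
fold H true  x = H + x
fold H false x = H ∸ suc x

fold-left-< : ∀ {H x} → x < H → H ∸ suc x < H
fold-left-< {suc H} {x} (s≤s _) = s≤s (m∸n≤m H x)

fold-< : ∀ {H x} s → x < H → fold H s x < H + H
fold-< {H} true  x<H = +-monoʳ-< H x<H
fold-< {H} false x<H = <-≤-trans (fold-left-< x<H) (m≤m+n H H)

fold-injective : ∀ {H x x′} s s′ → x < H → x′ < H →
  fold H s x ≡ fold H s′ x′ → (s ≡ s′) × (x ≡ x′)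
fold-injective {H} true true _ _ e = refl , +-cancelˡ-≡ H _ _ e
fold-injective {H} {x} true false _ x′<H e =
  ⊥-elim (<-irrefl refl (≤-<-trans (≤-trans (m≤m+n H x) (≤-reflexive e)) (fold-left-< x′<H)))
fold-injective {H} {x} {x′} false true x<H _ e =
  ⊥-elim (<-irrefl refl (≤-<-trans (≤-trans (m≤m+n H x′) (≤-reflexive (sym e))) (fold-left-< x<H)))
fold-injective {H} {x} {x′} false false x<H x′<H e = refl , suc-injective (+-cancelˡ-≡ (H ∸ suc x) _ _ (begin
  H ∸ suc x + suc x   ≡⟨ m∸n+n≡m x<H ⟩
  H                   ≡⟨ sym (m∸n+n≡m x′<H) ⟩
  H ∸ suc x′ + suc x′ ≡⟨ cong (_+ suc x′) (sym e) ⟩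
  H ∸ suc x + suc x′  ∎))

fold-mirror : ∀ {H x} s → x < H → fold H (not s) x + fold H s x ≡ pred (H + H)
fold-mirror {H} {x} true x<H = cong pred (begin
  suc (H ∸ suc x + (H + x)) ≡⟨ regroup (H ∸ suc x) H x ⟩
  (H ∸ suc x + suc x) + H   ≡⟨ cong (_+ H) (m∸n+n≡m x<H) ⟩
  H + H ∎)
  where
    regroup : ∀ d H x → suc (d + (H + x)) ≡ (d + suc x) + H
    regroup = solve-∀
fold-mirror {H} {x} false x<H = cong pred (begin
  suc (H + x + (H ∸ suc x)) ≡⟨ regroup (H ∸ suc x) H x ⟩
  (H ∸ suc x + suc x) + H   ≡⟨ cong (_+ H) (m∸n+n≡m x<H) ⟩
  H + H ∎)
  where
    regroup : ∀ d H x → suc (H + x + d) ≡ (d + suc x) + H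
    regroup = solve-∀

-- In a cycle whose length is a multiple of 4 the two neighbours of a vertex,
-- being 2 apart, have opposite phases.
phase-next-prev : ∀ P (i : Fin (suc P * 4)) → phase (toℕ (next i)) ≡ not (phase (toℕ (prev i)))
phase-next-prev P i with next-prev-gap i
... | inj₁ gap = trans (cong phase (sym gap)) (phase-+2 (toℕ (prev i)))
... | inj₂ gap = begin
  phase (toℕ (next i))                  ≡⟨ sym (phase-periodic (suc P) (toℕ (next i))) ⟩
  phase (toℕ (next i) + suc P * 4)      ≡⟨ cong phase (sym gap) ⟩
  phase (2 + toℕ (prev i))              ≡⟨ phase-+2 (toℕ (prev i)) ⟩
  not (phase (toℕ (prev i)))            ∎

coord : ∀ P → Bool → Fin (P * 4) → Fin (P * 4)
coord P s a = fromℕ< (subst (fold (P * 2) s (rank (toℕ a)) <_) (double P)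
                             (fold-< s (rank-< P (toℕ a) (toℕ<n a))))
  where
    double : ∀ P → P * 2 + P * 2 ≡ P * 4
    double = solve-∀

toℕ-coord : ∀ P s a → toℕ (coord P s a) ≡ fold (P * 2) s (rank (toℕ a))
toℕ-coord P s a = toℕ-fromℕ< _

coord-injective : ∀ P s s′ a a′ → coord P s a ≡ coord P s′ a′ → (s ≡ s′) × (rank (toℕ a) ≡ rank (toℕ a′))
coord-injective P s s′ a a′ e =
  fold-injective s s′ (rank-< P (toℕ a) (toℕ<n a)) (rank-< P (toℕ a′) (toℕ<n a′))
    (trans (sym (toℕ-coord P s a)) (trans (cong toℕ e) (toℕ-coord P s′ a′)))

module MagicLabelling (p q : ℕ) where

  m n M N : ℕ
  m = suc p * 4
  n = suc q * 4
  M = suc p * 2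
  N = suc q * 2

  open CycleProduct (suc (p * 4)) (suc (q * 4)) using (X; row; col; neighSum-diagonal)

  index : Fin m → Fin n → Fin (m * n)
  index a b = combine (coord (suc p) (phase (toℕ b)) a) (coord (suc q) (phase (toℕ a)) b)

  -- The index recovers phase and rank of both coordinates, hence both.
  index-injective : ∀ a b a′ b′ → index a b ≡ index a′ b′ → (a ≡ a′) × (b ≡ b′)
  index-injective a b a′ b′ e =
    toℕ-injective (phase-rank-injective (proj₁ same-col) (proj₂ same-row)) ,
    toℕ-injective (phase-rank-injective (proj₁ same-row) (proj₂ same-col))
    where
      same-coords : (coord (suc p) (phase (toℕ b)) a ≡ coord (suc p) (phase (toℕ b′)) a′)
                  × (coord (suc q) (phase (toℕ a)) b ≡ coord (suc q) (phase (toℕ a′)) b′)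
      same-coords = combine-injective (coord (suc p) (phase (toℕ b)) a) (coord (suc q) (phase (toℕ a)) b)
                                      (coord (suc p) (phase (toℕ b′)) a′) (coord (suc q) (phase (toℕ a′)) b′) e
      same-row : (phase (toℕ b) ≡ phase (toℕ b′)) × (rank (toℕ a) ≡ rank (toℕ a′))
      same-row = coord-injective (suc p) (phase (toℕ b)) (phase (toℕ b′)) a a′ (proj₁ same-coords)
      same-col : (phase (toℕ a) ≡ phase (toℕ a′)) × (rank (toℕ b) ≡ rank (toℕ b′))
      same-col = coord-injective (suc q) (phase (toℕ a)) (phase (toℕ a′)) b b′ (proj₂ same-coords)

  σ : Fin (m * n) → Fin (m * n)
  σ x = index (row x) (col x)

  σ-injective : Injective _≡_ _≡_ σ
  σ-injective {x} {x′} e = begin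
    x                          ≡⟨ sym (combine-remQuot {m} n x) ⟩
    combine (row x) (col x)    ≡⟨ uncurry (cong₂ combine) (index-injective (row x) (col x) (row x′) (col x′) e) ⟩
    combine (row x′) (col x′)  ≡⟨ combine-remQuot {m} n x′ ⟩
    x′ ∎

  ℓ : Labelling X
  ℓ = mk⤖ (σ-injective , injective⇒surjective σ σ-injective)

  K R : Fin m → Fin n → ℕ
  K a b = fold M (phase (toℕ b)) (rank (toℕ a))
  R a b = fold N (phase (toℕ a)) (rank (toℕ b))

  label-combine : ∀ a b → label X ℓ (combine a b) ≡ suc (n * K a b + R a b)
  label-combine a b = cong suc (begin
    toℕ (σ (combine a b))    ≡⟨ cong (λ r → toℕ (uncurry index r)) (remQuot-combine {m} {n} a b) ⟩
    toℕ (index a b)          ≡⟨ toℕ-combine (coord (suc p) (phase (toℕ b)) a) (coord (suc q) (phase (toℕ a)) b) ⟩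
    n * toℕ (coord (suc p) (phase (toℕ b)) a) + toℕ (coord (suc q) (phase (toℕ a)) b)
      ≡⟨ cong₂ (λ u v → n * u + v) (toℕ-coord (suc p) (phase (toℕ b)) a) (toℕ-coord (suc q) (phase (toℕ a)) b) ⟩
    n * K a b + R a b ∎)

  -- 4 + 2n(m - 1) + 2(n - 1), written with m - 1 = 2M - 1 and n - 1 = 2N - 1.
  magicConstant : ℕ
  magicConstant = 4 + n * (pred (M + M) + pred (M + M)) + (pred (N + N) + pred (N + N))

  K-mirror : ∀ a h → K a (next h) + K a (prev h) ≡ pred (M + M)
  K-mirror a h = trans (cong (λ s → fold M s (rank (toℕ a)) + K a (prev h)) (phase-next-prev q h))
                       (fold-mirror (phase (toℕ (prev h))) (rank-< (suc p) (toℕ a) (toℕ<n a)))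

  R-mirror : ∀ g b → R (next g) b + R (prev g) b ≡ pred (N + N)
  R-mirror g b = trans (cong (λ s → fold N s (rank (toℕ b)) + R (prev g) b) (phase-next-prev p g))
                       (fold-mirror (phase (toℕ (prev g))) (rank-< (suc q) (toℕ b) (toℕ<n b)))

  -- Every vertex sees the magic constant: expand the four diagonal labels
  -- and pair the K-parts along rows and the R-parts along columns.
  magic : ∀ x → neighSum X ℓ x ≡ magicConstant
  magic x = begin
    neighSum X ℓ x
      ≡⟨ neighSum-diagonal ℓ x ⟩
    (L a₁ b₁ + L a₁ b₂) + (L a₂ b₁ + L a₂ b₂)
      ≡⟨ cong₂ _+_ (cong₂ _+_ (label-combine a₁ b₁) (label-combine a₁ b₂))
                   (cong₂ _+_ (label-combine a₂ b₁) (label-combine a₂ b₂)) ⟩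
    (suc (n * K a₁ b₁ + R a₁ b₁) + suc (n * K a₁ b₂ + R a₁ b₂))
      + (suc (n * K a₂ b₁ + R a₂ b₁) + suc (n * K a₂ b₂ + R a₂ b₂))
      ≡⟨ regroup n (K a₁ b₁) (K a₁ b₂) (K a₂ b₁) (K a₂ b₂) (R a₁ b₁) (R a₁ b₂) (R a₂ b₁) (R a₂ b₂) ⟩
    4 + n * ((K a₁ b₁ + K a₁ b₂) + (K a₂ b₁ + K a₂ b₂)) + ((R a₁ b₁ + R a₂ b₁) + (R a₁ b₂ + R a₂ b₂))
      ≡⟨ cong₂ (λ u v → 4 + n * u + v) (cong₂ _+_ (K-mirror a₁ h) (K-mirror a₂ h))
                                        (cong₂ _+_ (R-mirror g b₁) (R-mirror g b₂)) ⟩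
    magicConstant ∎
    where
      g a₁ a₂ : Fin m
      g = row x
      a₁ = next g
      a₂ = prev g
      h b₁ b₂ : Fin n
      h = col x
      b₁ = next h
      b₂ = prev h
      L : Fin m → Fin n → ℕ
      L a b = label X ℓ (combine a b)
      regroup : ∀ n k₁₁ k₁₂ k₂₁ k₂₂ r₁₁ r₁₂ r₂₁ r₂₂ →
        (suc (n * k₁₁ + r₁₁) + suc (n * k₁₂ + r₁₂)) + (suc (n * k₂₁ + r₂₁) + suc (n * k₂₂ + r₂₂))
          ≡ 4 + n * ((k₁₁ + k₁₂) + (k₂₁ + k₂₂)) + ((r₁₁ + r₂₁) + (r₁₂ + r₂₂))
      regroup = solve-∀

  distanceMagic : IsDistanceMagic X
  distanceMagic = ℓ , magicConstant , s≤s z≤n , magic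

-- If w and w′ have u as their only common
-- neighbour, the balance condition at w and at w′ produces mates v, v′ of u
-- with the same label, so v = v′ is a common neighbour, i.e. u itself; then
-- ℓ(u) = N + 1 - ℓ(u), impossible when N is even.

unique-common-neighbour⇒unbalanced : ∀ X (w w′ u : Fin (order X)) →
  adj X w u ≡ true → adj X w′ u ≡ true →
  (∀ v → adj X w v ≡ true → adj X w′ v ≡ true → v ≡ u) →
  ¬ IsBalancedDistanceMagic X
unique-common-neighbour⇒unbalanced X w w′ u w~u w′~u unique (_ , 2∣N , ℓ , balanced)
  with balanced w u w~u | balanced w′ u w′~u
... | v , w~v , ℓv | v′ , w′~v′ , ℓv′ = odd (label X ℓ u) 2∣N (≤-trans (toℕ<n (Bijection.to ℓ u)) (n≤1+n _)) self-mate
  where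
    v≡v′ : v ≡ v′
    v≡v′ = Bijection.injective ℓ (toℕ-injective (suc-injective (trans ℓv (sym ℓv′))))
    v≡u : v ≡ u
    v≡u = unique v w~v (subst (λ t → adj X w′ t ≡ true) (sym v≡v′) w′~v′)
    self-mate : label X ℓ u ≡ suc (order X) ∸ label X ℓ u
    self-mate = trans (cong (label X ℓ) (sym v≡u)) ℓv
    -- x = N + 1 - x forces N + 1 = 2x to be even.
    odd : ∀ x {N} → 2 ∣ N → x ≤ suc N → x ≢ suc N ∸ x
    odd x {N} 2∣N x≤ e = case ∣1⇒≡1 (∣m+n∣m⇒∣n 2∣N+1 2∣N) of λ ()
      where
        2∣N+1 : 2 ∣ N + 1
        2∣N+1 = divides x (begin
          N + 1           ≡⟨ +-comm N 1 ⟩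
          suc N           ≡⟨ sym (m∸n+n≡m x≤) ⟩
          suc N ∸ x + x   ≡⟨ cong (_+ x) (sym e) ⟩
          x + x           ≡⟨ double x ⟩
          x * 2 ∎)
          where
            double : ∀ x → x + x ≡ x * 2
            double = solve-∀

module NotBalanced (m′ n′ : ℕ) where

  open CycleProduct (2 + m′) (2 + n′) using (m; n; X; row; col; adj-combine)

  vertex : Fin m → Fin n → Fin (m * n)
  vertex = combine

  u : Fin (m * n)
  u = vertex 1F 1F

  adj-to-u : ∀ i j → cycleAdj m i 1F ≡ true → cycleAdj n j 1F ≡ true → adj X (combine i j) u ≡ true
  adj-to-u i j i~1 j~1 = begin
    adj X (combine i j) u                            ≡⟨ adj-combine i j u ⟩
    cycleAdj m i (row u) ∧ cycleAdj n j (col u)      ≡⟨ cong (λ r → cycleAdj m i (proj₁ r) ∧ cycleAdj n j (proj₂ r))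
                                                              (remQuot-combine {m} {n} 1F 1F) ⟩
    cycleAdj m i 1F ∧ cycleAdj n j 1F              ≡⟨ cong₂ _∧_ i~1 j~1 ⟩
    true ∎

  ∧-true : ∀ {a b} → a ∧ b ≡ true → (a ≡ true) × (b ≡ true)
  ∧-true {true} {true} _ = refl , refl

  only-u : ∀ v → adj X (vertex 0F 0F) v ≡ true → adj X (vertex 2F 2F) v ≡ true → v ≡ u
  only-u v 00~v 22~v = begin
    v                         ≡⟨ sym (combine-remQuot {m} n v) ⟩
    combine (row v) (col v)   ≡⟨ cong₂ combine (common-neighbour-0-2 (row v) (proj₁ 0~) (proj₁ 2~))
                                               (common-neighbour-0-2 (col v) (proj₂ 0~) (proj₂ 2~)) ⟩
    u ∎
    where
      0~ : (cycleAdj m 0F (row v) ≡ true) × (cycleAdj n 0F (col v) ≡ true)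
      0~ = ∧-true (trans (sym (adj-combine 0F 0F v)) 00~v)
      2~ : (cycleAdj m 2F (row v) ≡ true) × (cycleAdj n 2F (col v) ≡ true)
      2~ = ∧-true (trans (sym (adj-combine 2F 2F v)) 22~v)

  notBalanced : ¬ IsBalancedDistanceMagic X
  notBalanced = unique-common-neighbour⇒unbalanced X (vertex 0F 0F) (vertex 2F 2F) u
    (adj-to-u 0F 0F (adj-0-1 {m′}) (adj-0-1 {n′})) (adj-to-u 2F 2F (adj-2-1 {m′}) (adj-2-1 {n′})) only-u

theorem3p2 : (m n : ℕ) → 4 ∣ m → 4 ∣ n → m > 4 → n > 4 →
    IsDistanceMagic (C m ×ᵍ C n) × ¬ IsBalancedDistanceMagic (C m ×ᵍ C n)
theorem3p2 .(0 * 4) n (divides 0 refl) _ () _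
theorem3p2 .(1 * 4) n (divides 1 refl) _ (s≤s (s≤s (s≤s (s≤s ())))) _
theorem3p2 m .(0 * 4) _ (divides 0 refl) _ ()
theorem3p2 m .(1 * 4) _ (divides 1 refl) _ (s≤s (s≤s (s≤s (s≤s ()))))
theorem3p2 .(suc (suc p) * 4) .(suc (suc q) * 4) (divides (suc (suc p)) refl) (divides (suc (suc q)) refl) _ _ =
  MagicLabelling.distanceMagic (suc p) (suc q) , NotBalanced.notBalanced (3 + p * 4) (3 + q * 4)
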